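{- Let $M=(W,E,C,\beta)$ be a model, $w\in W$, $a\in\mathsf{A}$ and $\phi$ a formula. Write $\langle\boxplus\rangle_x\psi$ for $\neg\boxplus_x\neg\psi$, and let $S$ range over finite nonempty subsets of $\mathsf{S}$. Then: (1) $M,w\models K_a\langle\boxplus\rangle_a\phi$ iff for all $u\in W$ with $C(a)\subseteq E(w,u)$ there is $S$ such that $(W,E,C^{a+S},\beta),u\models\phi$; (2) for any agent $c\neq a$ not occurring in $\phi$: $M,w\models(\equiv_a)_c\langle\boxplus\rangle_cK_a(\equiv_c)_a\phi$ iff there is $S$ such that for all $u\in W$ with $C(a)\subseteq E(w,u)$, $(W,E,C^{a+S},\beta),u\models\phi$; (3) $M,w\models\langle\boxplus\rangle_aK_a\phi$ iff there is $S$ such that for all $u\in W$ with $C^{a+S}(a)\subseteq E(w,u)$, $(W,E,C^{a+S},\beta),u\models\phi$.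
   Context: Fix countably infinite sets $\mathsf{P}$ (atoms), $\mathsf{A}$ (agents), $\mathsf{S}$ (skills). Formulas: $\phi ::= p \mid \neg\phi \mid (\phi\to\phi) \mid K_a\phi \mid C_G\phi \mid D_G\phi \mid E_G\phi \mid F_G\phi \mid (+_S)_a\phi \mid (-_S)_a\phi \mid (=_S)_a\phi \mid (\equiv_b)_a\phi \mid \boxplus_a\phi \mid \boxminus_a\phi \mid \Box_a\phi$ ($p\in\mathsf{P}$, $a,b\in\mathsf{A}$, $G\subseteq\mathsf{A}$ and $S\subseteq\mathsf{S}$ finite nonempty). An agent occurs in a formula if it appears as a subscript of some operator or as a member of some group $G$ in it. A model is $M=(W,E,C,\beta)$ with $W\neq\emptyset$, $E:W\times W\to\wp(\mathsf{S})$ symmetric with $E(w,u)=\mathsf{S}$ only if $w=u$, $C:\mathsf{A}\to\wp(\mathsf{S})$, $\beta:W\to\wp(\mathsf{P})$. Satisfaction: $M,w\models p$ iff $p\in\beta(w)$; Booleans as usual; $K_a\psi$ at $w$ iff $\psi$ at all $u$ with $C(a)\subseteq E(w,u)$; $E_G\psi$ iff $K_a\psi$ for all $a\in G$; $C_G\psi$ iff $E_G^n\psi$ for all $n\ge1$; $D_G\psi$ iff $\psi$ at all $u$ with $\bigcup_{a\in G}C(a)\subseteq E(w,u)$; $F_G\psi$ iff $\psi$ at all $u$ with $\bigcap_{a\in G}C(a)\subseteq E(w,u)$; $(+_S)_a\psi$, $(-_S)_a\psi$, $(=_S)_a\psi$, $(\equiv_b)_a\psi$ hold at $w$ iff $\psi$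 holds at $w$ in $(W,E,C',\beta)$ with $C'$ equal to $C$ except $C'(a)$ is respectively $C(a)\cup S$ (this $C'$ is denoted $C^{a+S}$), $C(a)\setminus S$, $S$, $C(b)$; $\boxplus_a\psi$, $\boxminus_a\psi$, $\Box_a\psi$ hold at $w$ iff $(+_S)_a\psi$, resp. $(-_S)_a\psi$, resp. $(=_S)_a\psi$ holds at $w$ for every finite nonempty $S\subseteq\mathsf{S}$. -}

module Defs where

open import Level using (0ℓ)
open import Data.Nat using (ℕ; zero; suc; _≟_)
open import Data.Product using (Σ; ∃; _×_; _,_)
open import Data.Sum using (_⊎_)
open import Data.Empty using (⊥)
open import Data.List.NonEmpty using (List⁺; toList)
open import Data.List.Membership.Propositional using (_∈_)
open import Relation.Nullary using (¬_; yes; no)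
open import Relation.Unary using (Pred; _⊆_; _∪_; _∩_; ∁)
open import Relation.Binary.PropositionalEquality using (_≡_)

Atom Agent Skill : Set
Atom  = ℕ
Agent = ℕ
Skill = ℕ

SkillSet : Set₁
SkillSet = Pred Skill 0ℓ

FinSet⁺ : Set → Set
FinSet⁺ A = List⁺ A

⟦_⟧ : FinSet⁺ Skill → SkillSet
⟦ S ⟧ s = s ∈ toList S

-- Formulas.  same a b φ  is  (≡_b)_a φ.
data Form : Set where
  atom     : Atom → Form
  ¬'_      : Form → Form
  _⇒_      : Form → Form → Form
  K        : Agent → Form → Form
  CK DK EK FK : FinSet⁺ Agent → Form → Form
  plus minus eqS : FinSet⁺ Skill → Agent → Form → Form
  same     : Agent → Agent → Form → Form
  boxplus boxminus box : Agent → Form → Form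

dia : Agent → Form → Form
dia x ψ = ¬' boxplus x (¬' ψ)

Occurs : Agent → Form → Set
Occurs c (atom p) = ⊥
Occurs c (¬' φ) = Occurs c φ
Occurs c (φ ⇒ ψ) = Occurs c φ ⊎ Occurs c ψ
Occurs c (K a φ) = c ≡ a ⊎ Occurs c φ
Occurs c (CK G φ) = c ∈ toList G ⊎ Occurs c φ
Occurs c (DK G φ) = c ∈ toList G ⊎ Occurs c φ
Occurs c (EK G φ) = c ∈ toList G ⊎ Occurs c φ
Occurs c (FK G φ) = c ∈ toList G ⊎ Occurs c φ
Occurs c (plus S a φ) = c ≡ a ⊎ Occurs c φ
Occurs c (minus S a φ) = c ≡ a ⊎ Occurs c φ
Occurs c (eqS S a φ) = c ≡ a ⊎ Occurs c φ
Occurs c (same a b φ) = c ≡ a ⊎ c ≡ b ⊎ Occurs c φ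
Occurs c (boxplus a φ) = c ≡ a ⊎ Occurs c φ
Occurs c (boxminus a φ) = c ≡ a ⊎ Occurs c φ
Occurs c (box a φ) = c ≡ a ⊎ Occurs c φ

record Model : Set₁ where
  field
    W     : Set
    w₀    : W                                   -- W ≠ ∅
    E     : W → W → SkillSet
    E-sym : ∀ w u → E w u ⊆ E u w
    E-full : ∀ w u → (∀ s → E w u s) → w ≡ u
    C     : Agent → SkillSet
    β     : W → Pred Atom 0ℓ
open Model public

update : (Agent → SkillSet) → Agent → SkillSet → Agent → SkillSet
update C a X b with b ≟ a
... | yes _ = X
... | no  _ = C b

withC : (M : Model) → (Agent → SkillSet) → Model
withC M C' = record M { C = C' }

addC addSub setC : Model → Agent → FinSet⁺ Skill → Model
addC M a S = withC M (update (C M) a (C M a ∪ ⟦ S ⟧))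
addSub M a S = withC M (update (C M) a (C M a ∩ ∁ ⟦ S ⟧))
setC M a S = withC M (update (C M) a ⟦ S ⟧)

copyC : Model → Agent → Agent → Model
copyC M a b = withC M (update (C M) a (C M b))

knows : (M : Model) → Agent → (W M → Set) → W M → Set
knows M a P w = ∀ u → C M a ⊆ E M w u → P u

everyone : (M : Model) → FinSet⁺ Agent → (W M → Set) → W M → Set
everyone M G P w = ∀ a → a ∈ toList G → knows M a P w

iterE : (M : Model) → FinSet⁺ Agent → ℕ → (W M → Set) → W M → Set
iterE M G zero P = P
iterE M G (suc n) P = everyone M G (iterE M G n P)

⋃C ⋂C : Model → FinSet⁺ Agent → SkillSet
⋃C M G s = ∃ λ a → a ∈ toList G × C M a s
⋂C M G s = ∀ a → a ∈ toList G → C M a s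

sat : (M : Model) → Form → W M → Set
sat M (atom p) w = β M w p
sat M (¬' φ) w = ¬ sat M φ w
sat M (φ ⇒ ψ) w = sat M φ w → sat M ψ w
sat M (K a φ) w = knows M a (sat M φ) w
sat M (EK G φ) w = everyone M G (sat M φ) w
sat M (CK G φ) w = ∀ n → iterE M G (suc n) (sat M φ) w
sat M (DK G φ) w = ∀ u → ⋃C M G ⊆ E M w u → sat M φ u
sat M (FK G φ) w = ∀ u → ⋂C M G ⊆ E M w u → sat M φ u
sat M (plus S a φ) w = sat (addC M a S) φ w
sat M (minus S a φ) w = sat (addSub M a S) φ w
sat M (eqS S a φ) w = sat (setC M a S) φ w
sat M (same a b φ) w = sat (copyC M a b) φ w
sat M (boxplus a φ) w = ∀ S → sat (addC M a S) φ w
sat M (boxminus a φ) w = ∀ S → sat (addSub M a S) φ w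
sat M (box a φ) w = ∀ S → sat (setC M a S) φ w

-- Under excluded middle ⟨⊞⟩_x ψ holds exactly when some S makes ψ true after
-- adding S to x's capability, which gives (1) pointwise under K_a and (3)
-- directly. For (2), (≡_a)_c turns c into a copy of a, ⟨⊞⟩_c lets the copy
-- choose S once for all a-accessible worlds, and (≡_c)_a hands the enlarged
-- capability back to a. The resulting assignment agrees with C^{a+S}
-- everywhere except at c, and satisfaction of a formula not mentioning c is
-- insensitive to the capability of c.
module Submission where

open import Defs
open import Level using (0ℓ)
open import Axiom.ExcludedMiddle using (ExcludedMiddle)
open import Axiom.DoubleNegationElimination using (em⇒dne)
open import Data.Product using (∃; _×_; _,_; proj₁; proj₂; map₂)
open import Data.Sum using (_⊎_; inj₁; inj₂)
open import Data.Nat using (zero; suc; _≟_)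
open import Data.Empty using (⊥-elim)
open import Data.List.NonEmpty using (toList)
open import Data.List.Membership.Propositional using (_∈_)
open import Function using (_∘_)
open import Function.Bundles using (_⇔_; mk⇔; Equivalence)
open Equivalence using (to; from)
open import Function.Construct.Composition using (_⇔-∘_)
open import Relation.Nullary using (¬_; yes; no)
open import Relation.Nullary.Negation using (∃⟶¬∀¬; ¬∃⟶∀¬)
open import Relation.Unary using (_⊆_; _≐_; _∪_; _∩_; ∁)
open import Relation.Unary.Properties using (≐-refl; ≐-sym; ≐-trans)
open import Relation.Binary.PropositionalEquality using (_≡_; _≢_; refl; sym; subst)

Capability : Set₁
Capability = Agent → SkillSet

update-≡ : ∀ (C : Capability) a X → update C a X a ≡ X
update-≡ C a X with a ≟ a
... | yes _ = refl
... | no a≢a = ⊥-elim (a≢a refl)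

update-≢ : ∀ (C : Capability) a X {b} → b ≢ a → update C a X b ≡ C b
update-≢ C a X {b} b≢a with b ≟ a
... | yes b≡a = ⊥-elim (b≢a b≡a)
... | no _ = refl

≡⇒≐ : ∀ {X Y : SkillSet} → X ≡ Y → X ≐ Y
≡⇒≐ refl = ≐-refl

_≐_except_ : Capability → Capability → Agent → Set
C₁ ≐ C₂ except c = ∀ b → b ≢ c → C₁ b ≐ C₂ b

≐-except-sym : ∀ {C₁ C₂ c} → C₁ ≐ C₂ except c → C₂ ≐ C₁ except c
≐-except-sym C₁≐C₂ b b≢c = ≐-sym (C₁≐C₂ b b≢c)

≐-except-trans : ∀ {C₁ C₂ C₃ c} → C₁ ≐ C₂ except c → C₂ ≐ C₃ except c → C₁ ≐ C₃ except c
≐-except-trans C₁≐C₂ C₂≐C₃ b b≢c = ≐-trans (C₁≐C₂ b b≢c) (C₂≐C₃ b b≢c)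

update-≐-except : ∀ (C : Capability) c X → update C c X ≐ C except c
update-≐-except C c X b b≢c = ≡⇒≐ (update-≢ C c X b≢c)

update-cong-≐-except : ∀ {C₁ C₂ c X₁ X₂} b → C₁ ≐ C₂ except c → X₁ ≐ X₂ →
  update C₁ b X₁ ≐ update C₂ b X₂ except c
update-cong-≐-except b C₁≐C₂ X₁≐X₂ d d≢c with d ≟ b
... | yes _ = X₁≐X₂
... | no _ = C₁≐C₂ d d≢c

∪-congˡ : ∀ {X Y : SkillSet} (Z : SkillSet) → X ≐ Y → (X ∪ Z) ≐ (Y ∪ Z)
∪-congˡ Z (X⊆Y , Y⊆X) =
  (λ { (inj₁ x) → inj₁ (X⊆Y x) ; (inj₂ z) → inj₂ z }) ,
  (λ { (inj₁ y) → inj₁ (Y⊆X y) ; (inj₂ z) → inj₂ z })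

∩-congˡ : ∀ {X Y : SkillSet} (Z : SkillSet) → X ≐ Y → (X ∩ Z) ≐ (Y ∩ Z)
∩-congˡ Z (X⊆Y , Y⊆X) = (λ (x , z) → X⊆Y x , z) , (λ (y , z) → Y⊆X y , z)

module _ (M : Model) {c : Agent} {C₁ C₂ : Capability} (C₁≐C₂ : C₁ ≐ C₂ except c) where

  ⊆-transport : ∀ {b} → b ≢ c → ∀ {X : SkillSet} → C₂ b ⊆ X → C₁ b ⊆ X
  ⊆-transport b≢c C₂b⊆X s∈ = C₂b⊆X (proj₁ (C₁≐C₂ _ b≢c) s∈)

  iterE-transport : ∀ G {P Q : W M → Set} → (∀ {b} → b ∈ toList G → b ≢ c) →
    (∀ {w} → P w → Q w) → ∀ n {w} → iterE (withC M C₁) G n P w → iterE (withC M C₂) G n Q w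
  iterE-transport G G∌c P⇒Q zero h = P⇒Q h
  iterE-transport G G∌c P⇒Q (suc n) h b b∈G u C₂b⊆E =
    iterE-transport G G∌c P⇒Q n (h b b∈G u (⊆-transport (G∌c b∈G) C₂b⊆E))

head-≢ : ∀ {c a : Agent} {P : Set} → ¬ (c ≡ a ⊎ P) → a ≢ c
head-≢ c∉ a≡c = c∉ (inj₁ (sym a≡c))

members-≢ : ∀ {c : Agent} {G : FinSet⁺ Agent} {P : Set} → ¬ (c ∈ toList G ⊎ P) →
  ∀ {b} → b ∈ toList G → b ≢ c
members-≢ c∉ b∈G refl = c∉ (inj₁ b∈G)

sat-transport : ∀ M {c C₁ C₂} φ → C₁ ≐ C₂ except c → ¬ Occurs c φ →
  ∀ {w} → sat (withC M C₁) φ w → sat (withC M C₂) φ w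
sat-transport M (atom p) C₁≐C₂ c∉ h = h
sat-transport M (¬' φ) C₁≐C₂ c∉ h =
  h ∘ sat-transport M φ (≐-except-sym C₁≐C₂) c∉
sat-transport M (φ ⇒ ψ) C₁≐C₂ c∉ h =
  sat-transport M ψ C₁≐C₂ (c∉ ∘ inj₂) ∘ h ∘ sat-transport M φ (≐-except-sym C₁≐C₂) (c∉ ∘ inj₁)
sat-transport M (K a φ) C₁≐C₂ c∉ h u C₂a⊆E =
  sat-transport M φ C₁≐C₂ (c∉ ∘ inj₂) (h u (⊆-transport M C₁≐C₂ (head-≢ c∉) C₂a⊆E))
sat-transport M (CK G φ) C₁≐C₂ c∉ h n =
  iterE-transport M C₁≐C₂ G (members-≢ c∉) (sat-transport M φ C₁≐C₂ (c∉ ∘ inj₂)) (suc n) (h n)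
sat-transport M (DK G φ) C₁≐C₂ c∉ h u ⋃C₂⊆E =
  sat-transport M φ C₁≐C₂ (c∉ ∘ inj₂)
    (h u (λ (b , b∈G , s∈C₁b) → ⋃C₂⊆E (b , b∈G , proj₁ (C₁≐C₂ b (members-≢ c∉ b∈G)) s∈C₁b)))
sat-transport M (EK G φ) C₁≐C₂ c∉ h b b∈G u C₂b⊆E =
  sat-transport M φ C₁≐C₂ (c∉ ∘ inj₂)
    (h b b∈G u (⊆-transport M C₁≐C₂ (members-≢ c∉ b∈G) C₂b⊆E))
sat-transport M (FK G φ) C₁≐C₂ c∉ h u ⋂C₂⊆E =
  sat-transport M φ C₁≐C₂ (c∉ ∘ inj₂)
    (h u (λ s∈⋂C₁ → ⋂C₂⊆E (λ b b∈G → proj₁ (C₁≐C₂ b (members-≢ c∉ b∈G)) (s∈⋂C₁ b b∈G))))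
sat-transport M (plus S a φ) C₁≐C₂ c∉ =
  sat-transport M φ (update-cong-≐-except a C₁≐C₂ (∪-congˡ ⟦ S ⟧ (C₁≐C₂ a (head-≢ c∉)))) (c∉ ∘ inj₂)
sat-transport M (minus S a φ) C₁≐C₂ c∉ =
  sat-transport M φ (update-cong-≐-except a C₁≐C₂ (∩-congˡ (∁ ⟦ S ⟧) (C₁≐C₂ a (head-≢ c∉)))) (c∉ ∘ inj₂)
sat-transport M (eqS S a φ) C₁≐C₂ c∉ =
  sat-transport M φ (update-cong-≐-except a C₁≐C₂ ≐-refl) (c∉ ∘ inj₂)
sat-transport M (same a b φ) C₁≐C₂ c∉ =
  sat-transport M φ (update-cong-≐-except a C₁≐C₂ (C₁≐C₂ b (head-≢ (c∉ ∘ inj₂)))) (c∉ ∘ inj₂ ∘ inj₂)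
sat-transport M (boxplus a φ) C₁≐C₂ c∉ h S =
  sat-transport M φ (update-cong-≐-except a C₁≐C₂ (∪-congˡ ⟦ S ⟧ (C₁≐C₂ a (head-≢ c∉)))) (c∉ ∘ inj₂) (h S)
sat-transport M (boxminus a φ) C₁≐C₂ c∉ h S =
  sat-transport M φ (update-cong-≐-except a C₁≐C₂ (∩-congˡ (∁ ⟦ S ⟧) (C₁≐C₂ a (head-≢ c∉)))) (c∉ ∘ inj₂) (h S)
sat-transport M (box a φ) C₁≐C₂ c∉ h S =
  sat-transport M φ (update-cong-≐-except a C₁≐C₂ ≐-refl) (c∉ ∘ inj₂) (h S)

sat-≐-except : ∀ M {c C₁ C₂} φ → C₁ ≐ C₂ except c → ¬ Occurs c φ →
  ∀ {w} → sat (withC M C₁) φ w ⇔ sat (withC M C₂) φ w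
sat-≐-except M φ C₁≐C₂ c∉ =
  mk⇔ (sat-transport M φ C₁≐C₂ c∉) (sat-transport M φ (≐-except-sym C₁≐C₂) c∉)

sat-dia : ExcludedMiddle 0ℓ → ∀ M a ψ {w} →
  sat M (dia a ψ) w ⇔ (∃ λ S → sat (addC M a S) ψ w)
sat-dia em M a ψ = mk⇔ (λ h → em⇒dne em (h ∘ ¬∃⟶∀¬)) ∃⟶¬∀¬

module _ (M : Model) {a c : Agent} (c≢a : c ≢ a) (S : FinSet⁺ Skill) where

  copy-then-add : Capability
  copy-then-add = C (addC (copyC M c a) c S)

  copy-then-add-a : copy-then-add a ≐ C M a
  copy-then-add-a =
    ≐-trans (update-≐-except _ c _ a (c≢a ∘ sym)) (update-≐-except (C M) c (C M a) a (c≢a ∘ sym))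

  copy-then-add-c : copy-then-add c ≐ (C M a ∪ ⟦ S ⟧)
  copy-then-add-c = ≡⇒≐ (subst (λ X → copy-then-add c ≡ X ∪ ⟦ S ⟧)
    (update-≡ (C M) c (C M a)) (update-≡ _ c _))

  hand-back-≐-addC : update copy-then-add a (copy-then-add c) ≐ C (addC M a S) except c
  hand-back-≐-addC = update-cong-≐-except a
    (≐-except-trans (update-≐-except _ c _) (update-≐-except (C M) c (C M a)))
    copy-then-add-c

  sat-K-hand-back : ∀ φ → ¬ Occurs c φ → ∀ {w} →
    sat (addC (copyC M c a) c S) (K a (same a c φ)) w
      ⇔ (∀ u → C M a ⊆ E M w u → sat (addC M a S) φ u)
  sat-K-hand-back φ c∉φ {w} = mk⇔
    (λ h u Ca⊆E → to (hand-back u) (h u (λ {s} s∈ → Ca⊆E (proj₁ copy-then-add-a s∈))))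
    (λ h u Ca⊆E → from (hand-back u) (h u (λ {s} s∈ → Ca⊆E (proj₂ copy-then-add-a s∈))))
    where
    hand-back : ∀ u → sat (copyC (addC (copyC M c a) c S) a c) φ u ⇔ sat (addC M a S) φ u
    hand-back u = sat-≐-except M φ hand-back-≐-addC c∉φ

sat-K-dia : ExcludedMiddle 0ℓ → ∀ M a φ {w} →
  sat M (K a (dia a φ)) w ⇔ (∀ u → C M a ⊆ E M w u → ∃ λ S → sat (addC M a S) φ u)
sat-K-dia em M a φ = mk⇔
  (λ h u Ca⊆E → to (sat-dia em M a φ) (h u Ca⊆E))
  (λ h u Ca⊆E → from (sat-dia em M a φ) (h u Ca⊆E))

sat-copy-dia-K-copy : ExcludedMiddle 0ℓ → ∀ M {a c} → c ≢ a → ∀ φ → ¬ Occurs c φ → ∀ {w} →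
  sat M (same c a (dia c (K a (same a c φ)))) w
    ⇔ (∃ λ S → ∀ u → C M a ⊆ E M w u → sat (addC M a S) φ u)
sat-copy-dia-K-copy em M {a} {c} c≢a φ c∉φ =
  mk⇔ (map₂ λ {S} → to (sat-K-hand-back M c≢a S φ c∉φ))
      (map₂ λ {S} → from (sat-K-hand-back M c≢a S φ c∉φ))
  ⇔-∘ sat-dia em (copyC M c a) c (K a (same a c φ))

proposition3 : ExcludedMiddle 0ℓ → (M : Model) (w : W M) (a : Agent) (φ : Form) →
    (sat M (K a (dia a φ)) w
      ⇔ (∀ u → C M a ⊆ E M w u → ∃ λ S → sat (addC M a S) φ u))
    × (∀ c → c ≢ a → ¬ Occurs c φ →
        (sat M (same c a (dia c (K a (same a c φ)))) w
          ⇔ (∃ λ S → ∀ u → C M a ⊆ E M w u → sat (addC M a S) φ u)))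
    × (sat M (dia a (K a φ)) w
      ⇔ (∃ λ S → ∀ u → C (addC M a S) a ⊆ E M w u → sat (addC M a S) φ u))
proposition3 em M w a φ =
  sat-K-dia em M a φ ,
  (λ c c≢a c∉φ → sat-copy-dia-K-copy em M c≢a φ c∉φ) ,
  sat-dia em M a (K a φ)
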